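{- Let $a_0,\ldots,a_{15}\in\mathbb{Z}$, define $b_i=(a_i+a_{i+8})+(a_{i+4}+a_{i+12})$ ($0\le i\le3$) and $d_i=a_i-a_{i+8}$ ($0\le i\le 7$), and let $d=(d_0+d_2)(d_4+d_6)+(d_1+d_3)(d_5+d_7)$ and $d^*=d_0d_2+d_4d_6+d_1d_3+d_5d_7$. If $b_0+b_2\not\equiv b_1+b_3\pmod 2$, then $F(d_0,\ldots,d_7)^2\equiv 1-8d^*-8d\pmod{16}$.
   Context: For $k\in\{0,1\}$ let $f_k(x,y,z,w)=x^2+y^2+(-1)^kz^2+(-1)^kw^2$, and $F(w_0,\ldots,w_7)=f_0(w_0-w_2,w_4-w_6,w_1-w_3,w_5-w_7)\,f_1(w_0+w_2,w_4+w_6,w_1+w_3,w_5+w_7)$. -}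

module Defs where

open import Data.Nat using (ℕ)
open import Data.Fin using (Fin; #_; _↑ˡ_; _↑ʳ_)
open import Data.Integer using (ℤ; _+_; _-_; _*_; -_; +_)
open import Data.Integer.Divisibility using (_∣_)

_≡_[mod_] : ℤ → ℤ → ℕ → Set
x ≡ y [mod m ] = (+ m) ∣ (x - y)

sgn : Fin 2 → ℤ
sgn Fin.zero = + 1
sgn (Fin.suc _) = - (+ 1)

f : Fin 2 → ℤ → ℤ → ℤ → ℤ → ℤ
f k x y z w = x * x + y * y + sgn k * (z * z) + sgn k * (w * w)

F : (Fin 8 → ℤ) → ℤ
F w = f (# 0) (w (# 0) - w (# 2)) (w (# 4) - w (# 6)) (w (# 1) - w (# 3)) (w (# 5) - w (# 7))
    * f (# 1) (w (# 0) + w (# 2)) (w (# 4) + w (# 6)) (w (# 1) + w (# 3)) (w (# 5) + w (# 7))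


b : (Fin 16 → ℤ) → Fin 4 → ℤ
b a Fin.zero = (a (# 0) + a (# 8)) + (a (# 4) + a (# 12))
b a (Fin.suc Fin.zero) = (a (# 1) + a (# 9)) + (a (# 5) + a (# 13))
b a (Fin.suc (Fin.suc Fin.zero)) = (a (# 2) + a (# 10)) + (a (# 6) + a (# 14))
b a (Fin.suc (Fin.suc (Fin.suc Fin.zero))) = (a (# 3) + a (# 11)) + (a (# 7) + a (# 15))

dv : (Fin 16 → ℤ) → Fin 8 → ℤ
dv a i = a (i ↑ˡ 8) - a (8 ↑ʳ i)

dd : (Fin 16 → ℤ) → ℤ
dd a = (dv a (# 0) + dv a (# 2)) * (dv a (# 4) + dv a (# 6))
     + (dv a (# 1) + dv a (# 3)) * (dv a (# 5) + dv a (# 7))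

dstar : (Fin 16 → ℤ) → ℤ
dstar a = dv a (# 0) * dv a (# 2) + dv a (# 4) * dv a (# 6)
        + dv a (# 1) * dv a (# 3) + dv a (# 5) * dv a (# 7)

-- For the four pairs (u, v) = (d₀, d₂), (d₄, d₆), (d₁, d₃), (d₅, d₇) put s = u − v and use
-- (u + v)² = s² + 4uv. With A = s₁² + s₂², B = s₃² + s₄² and P = u₁v₁ + u₂v₂ − u₃v₃ − u₄v₄ this gives
-- F = (A + B)(A − B + 4P) = A² − B² + 4P(A + B) =: G.
-- Since x ≡ y (mod 2k) implies x² ≡ y² (mod 4k), A and B mod 4, hence G mod 8, hence G² mod 16,
-- depend only on the parities of s₁, …, s₄ and P. Modulo 2 also d ≡ s₁s₂ + s₃s₄ and d* ≡ P, and the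
-- hypothesis says s₁ + s₂ ≢ s₃ + s₄. So the claim reduces to 32 parity patterns, decided by evaluation.

module Submission where

open import Defs
open import Data.Fin using (Fin; #_; toℕ; fromℕ<)
open import Data.Fin.Properties using (all?; toℕ-fromℕ<)
open import Data.Integer using (ℤ; _+_; _-_; _*_; -_; +_)
open import Data.Integer.DivMod using (_%ℕ_; _/ℕ_; a≡a%ℕn+[a/ℕn]*n; n%ℕd<d)
open import Data.Integer.Properties using (pos-*)
import Data.Integer.Divisibility.Signed as Signed
open Signed using (divides; ∣⇒∣ᵤ; ∣m∣n⇒∣m+n; ∣m⇒∣-m; ∣n⇒∣m*n; ∣m⇒∣m*n; _∣?_)
open import Data.Integer.Tactic.RingSolver using (solve-∀)
open import Data.Nat as ℕ using (ℕ)
open import Data.Product using (Σ; _,_)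
open import Function using (_∘_)
open import Relation.Binary.Bundles using (Setoid)
open import Relation.Binary.Structures using (IsEquivalence)
open import Relation.Binary.PropositionalEquality using (_≡_; refl; sym; trans; cong; subst; module ≡-Reasoning)
import Relation.Binary.Reasoning.Setoid as ≈-Reasoning
open import Relation.Nullary using (¬_; Dec)
open import Relation.Nullary.Decidable using (map′; ¬?; _→-dec_; from-yes)

-- The relation _≡_[mod_] of Defs unfolds to a divisibility statement about x - y, from which
-- Agda cannot infer x and y. A record type is injective, so congruence lemmas for it can take
-- all their arguments implicitly.

infix 4 _≈_[mod_] _≈?_[mod_]

record _≈_[mod_] (x y : ℤ) (m : ℕ) : Set where
  constructor congruent
  field divides-difference : + m Signed.∣ x - y

open _≈_[mod_]

≈⇒≡-mod : ∀ {m x y} → x ≈ y [mod m ] → (x ≡ y [mod m ])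
≈⇒≡-mod = ∣⇒∣ᵤ ∘ divides-difference

_≈?_[mod_] : ∀ x y m → Dec (x ≈ y [mod m ])
x ≈? y [mod m ] = map′ congruent divides-difference (+ m ∣? x - y)

module _ {m : ℕ} where

  ≈-by-difference : ∀ {x y d} → d ≡ x - y → + m Signed.∣ d → x ≈ y [mod m ]
  ≈-by-difference eq m∣d = congruent (subst (+ m Signed.∣_) eq m∣d)

  ≈-by-quotient : ∀ {x y} q → x ≡ y + q * + m → x ≈ y [mod m ]
  ≈-by-quotient {x} {y} q x≡y+qm = ≈-by-difference (cong (_- y) (sym x≡y+qm)) (divides q (identity y q (+ m)))
    where identity : ∀ y q m → (y + q * m) - y ≡ q * m
          identity = solve-∀

  ≈-quotient : ∀ {x y} → x ≈ y [mod m ] → Σ ℤ λ q → x ≡ y + q * + m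
  ≈-quotient {x} {y} (congruent (divides q x-y≡qm)) = q , trans (identity x y) (cong (λ d → y + d) x-y≡qm)
    where identity : ∀ x y → x ≡ y + (x - y)
          identity = solve-∀

  ≈-reflexive : ∀ {x y} → x ≡ y → x ≈ y [mod m ]
  ≈-reflexive {x} {y} x≡y = ≈-by-quotient (+ 0) (trans x≡y (identity y (+ m)))
    where identity : ∀ y m → y ≡ y + + 0 * m
          identity = solve-∀

  ≈-refl : ∀ {x} → x ≈ x [mod m ]
  ≈-refl = ≈-reflexive refl

  ≈-sym : ∀ {x y} → x ≈ y [mod m ] → y ≈ x [mod m ]
  ≈-sym {x} {y} (congruent m∣x-y) = ≈-by-difference (identity x y) (∣m⇒∣-m m∣x-y)
    where identity : ∀ x y → - (x - y) ≡ y - x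
          identity = solve-∀

  ≈-trans : ∀ {x y z} → x ≈ y [mod m ] → y ≈ z [mod m ] → x ≈ z [mod m ]
  ≈-trans {x} {y} {z} (congruent m∣x-y) (congruent m∣y-z) = ≈-by-difference (identity x y z) (∣m∣n⇒∣m+n m∣x-y m∣y-z)
    where identity : ∀ x y z → (x - y) + (y - z) ≡ x - z
          identity = solve-∀

  ≈-isEquivalence : IsEquivalence _≈_[mod m ]
  ≈-isEquivalence = record { refl = ≈-refl ; sym = ≈-sym ; trans = ≈-trans }

  +-cong : ∀ {x x′ y y′} → x ≈ x′ [mod m ] → y ≈ y′ [mod m ] → x + y ≈ x′ + y′ [mod m ]
  +-cong {x} {x′} {y} {y′} (congruent m∣x-x′) (congruent m∣y-y′) = ≈-by-difference (identity x x′ y y′) (∣m∣n⇒∣m+n m∣x-x′ m∣y-y′)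
    where identity : ∀ x x′ y y′ → (x - x′) + (y - y′) ≡ (x + y) - (x′ + y′)
          identity = solve-∀

  -‿cong : ∀ {x x′} → x ≈ x′ [mod m ] → - x ≈ - x′ [mod m ]
  -‿cong {x} {x′} (congruent m∣x-x′) = ≈-by-difference (identity x x′) (∣m⇒∣-m m∣x-x′)
    where identity : ∀ x x′ → - (x - x′) ≡ - x - - x′
          identity = solve-∀

  *-cong : ∀ {x x′ y y′} → x ≈ x′ [mod m ] → y ≈ y′ [mod m ] → x * y ≈ x′ * y′ [mod m ]
  *-cong {x} {x′} {y} {y′} (congruent m∣x-x′) (congruent m∣y-y′) =
    ≈-by-difference (identity x x′ y y′) (∣m∣n⇒∣m+n (∣m⇒∣m*n y m∣x-x′) (∣n⇒∣m*n x′ m∣y-y′))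
    where identity : ∀ x x′ y y′ → (x - x′) * y + x′ * (y - y′) ≡ x * y - x′ * y′
          identity = solve-∀

≈-setoid : ℕ → Setoid _ _
≈-setoid m = record { isEquivalence = ≈-isEquivalence {m} }

*-scale : ∀ k {m x y} → x ≈ y [mod m ] → + k * x ≈ + k * y [mod k ℕ.* m ]
*-scale k {m} {y = y} x≈y with ≈-quotient x≈y
... | q , refl = ≈-by-quotient q (begin
  + k * (y + q * + m)        ≡⟨ identity (+ k) y q (+ m) ⟩
  + k * y + q * (+ k * + m)  ≡⟨ cong (λ km → + k * y + q * km) (pos-* k m) ⟨
  + k * y + q * + (k ℕ.* m)  ∎)
  where
  open ≡-Reasoning
  identity : ∀ k y q m → k * (y + q * m) ≡ k * y + q * (k * m)
  identity = solve-∀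

square-cong : ∀ k {x y} → x ≈ y [mod 2 ℕ.* k ] → x * x ≈ y * y [mod 4 ℕ.* k ]
square-cong k {y = y} x≈y with ≈-quotient x≈y
... | q , refl = ≈-by-quotient (q * y + q * q * + k) (begin
  (y + q * + (2 ℕ.* k)) * (y + q * + (2 ℕ.* k))  ≡⟨ cong (λ t → (y + q * t) * (y + q * t)) (pos-* 2 k) ⟩
  (y + q * (+ 2 * + k)) * (y + q * (+ 2 * + k))  ≡⟨ identity y q (+ k) ⟩
  y * y + (q * y + q * q * + k) * (+ 4 * + k)    ≡⟨ cong (λ t → y * y + (q * y + q * q * + k) * t) (pos-* 4 k) ⟨
  y * y + (q * y + q * q * + k) * + (4 ℕ.* k)    ∎)
  where
  open ≡-Reasoning
  identity : ∀ y q k → (y + q * (+ 2 * k)) * (y + q * (+ 2 * k)) ≡ y * y + (q * y + q * q * k) * (+ 4 * k)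
  identity = solve-∀

parity : ∀ x → Σ (Fin 2) λ e → x ≈ + toℕ e [mod 2 ]
parity x = e , ≈-by-quotient (x /ℕ 2) (trans (a≡a%ℕn+[a/ℕn]*n x 2) (cong (λ r → + r + (x /ℕ 2) * + 2) (sym (toℕ-fromℕ< x%2<2))))
  where
  x%2<2 : x %ℕ 2 ℕ.< 2
  x%2<2 = n%ℕd<d x 2
  e : Fin 2
  e = fromℕ< x%2<2

sumSq : ℤ → ℤ → ℤ
sumSq x y = x * x + y * y

G : ℤ → ℤ → ℤ → ℤ → ℤ → ℤ
G s₁ s₂ s₃ s₄ P = let A = sumSq s₁ s₂; B = sumSq s₃ s₄ in A * A - B * B + + 4 * (P * (A + B))

F≡G : ∀ w → F w ≡ G (w (# 0) - w (# 2)) (w (# 4) - w (# 6)) (w (# 1) - w (# 3)) (w (# 5) - w (# 7))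
                      (w (# 0) * w (# 2) + w (# 4) * w (# 6) - w (# 1) * w (# 3) - w (# 5) * w (# 7))
F≡G w = identity (w (# 0)) (w (# 2)) (w (# 4)) (w (# 6)) (w (# 1)) (w (# 3)) (w (# 5)) (w (# 7))
  where
  -- stated in unfolded form, since the ring solver does not look through f and G
  identity : ∀ u₁ v₁ u₂ v₂ u₃ v₃ u₄ v₄ →
    let s₁ = u₁ - v₁; s₂ = u₂ - v₂; s₃ = u₃ - v₃; s₄ = u₄ - v₄
        X₁ = u₁ + v₁; X₂ = u₂ + v₂; X₃ = u₃ + v₃; X₄ = u₄ + v₄
        A = s₁ * s₁ + s₂ * s₂; B = s₃ * s₃ + s₄ * s₄
        P = u₁ * v₁ + u₂ * v₂ - u₃ * v₃ - u₄ * v₄ in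
    (s₁ * s₁ + s₂ * s₂ + + 1 * (s₃ * s₃) + + 1 * (s₄ * s₄))
      * (X₁ * X₁ + X₂ * X₂ + - + 1 * (X₃ * X₃) + - + 1 * (X₄ * X₄))
    ≡ A * A - B * B + + 4 * (P * (A + B))
  identity = solve-∀

sumSq-cong : ∀ {m x x′ y y′} → x ≈ x′ [mod m ] → y ≈ y′ [mod m ] → sumSq x y ≈ sumSq x′ y′ [mod m ]
sumSq-cong x≈x′ y≈y′ = +-cong (*-cong x≈x′ x≈x′) (*-cong y≈y′ y≈y′)

G-cong : ∀ {s₁ s₂ s₃ s₄ P t₁ t₂ t₃ t₄ Q} →
         s₁ ≈ t₁ [mod 2 ] → s₂ ≈ t₂ [mod 2 ] → s₃ ≈ t₃ [mod 2 ] → s₄ ≈ t₄ [mod 2 ] → P ≈ Q [mod 2 ] →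
         G s₁ s₂ s₃ s₄ P ≈ G t₁ t₂ t₃ t₄ Q [mod 8 ]
G-cong r₁ r₂ r₃ r₄ ρ =
  +-cong (+-cong (square-cong 2 (sumSq-mod-4 r₁ r₂)) (-‿cong (square-cong 2 (sumSq-mod-4 r₃ r₄))))
         (*-scale 4 (*-cong ρ (+-cong (sumSq-cong r₁ r₂) (sumSq-cong r₃ r₄))))
  where
  sumSq-mod-4 : ∀ {x x′ y y′} → x ≈ x′ [mod 2 ] → y ≈ y′ [mod 2 ] → sumSq x y ≈ sumSq x′ y′ [mod 4 ]
  sumSq-mod-4 x≈x′ y≈y′ = +-cong (square-cong 1 x≈x′) (square-cong 1 y≈y′)

R : ℤ → ℤ → ℤ
R x y = + 1 - + 8 * x - + 8 * y

R-cong : ∀ {x x′ y y′} → x ≈ x′ [mod 2 ] → y ≈ y′ [mod 2 ] → R x y ≈ R x′ y′ [mod 16 ]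
R-cong x≈x′ y≈y′ = +-cong (+-cong (≈-refl {x = + 1}) (-‿cong (*-scale 8 x≈x′))) (-‿cong (*-scale 8 y≈y′))

bit : Fin 2 → ℤ
bit e = + toℕ e

G²≈R-on-bits : ∀ e₁ e₂ e₃ e₄ π → let s₁ = bit e₁; s₂ = bit e₂; s₃ = bit e₃; s₄ = bit e₄; P = bit π in
  ¬ (s₁ + s₂ ≈ s₃ + s₄ [mod 2 ]) → G s₁ s₂ s₃ s₄ P * G s₁ s₂ s₃ s₄ P ≈ R P (s₁ * s₂ + s₃ * s₄) [mod 16 ]
G²≈R-on-bits = from-yes (all? λ e₁ → all? λ e₂ → all? λ e₃ → all? λ e₄ → all? λ π →
  let s₁ = bit e₁; s₂ = bit e₂; s₃ = bit e₃; s₄ = bit e₄; P = bit π in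
  ¬? (s₁ + s₂ ≈? s₃ + s₄ [mod 2 ]) →-dec (G s₁ s₂ s₃ s₄ P * G s₁ s₂ s₃ s₄ P ≈? R P (s₁ * s₂ + s₃ * s₄) [mod 16 ]))

G²≈R : ∀ s₁ s₂ s₃ s₄ P → ¬ (s₁ + s₂ ≈ s₃ + s₄ [mod 2 ]) →
       G s₁ s₂ s₃ s₄ P * G s₁ s₂ s₃ s₄ P ≈ R P (s₁ * s₂ + s₃ * s₄) [mod 16 ]
G²≈R s₁ s₂ s₃ s₄ P s₁₂≉s₃₄ with parity s₁ | parity s₂ | parity s₃ | parity s₄ | parity P
... | e₁ , r₁ | e₂ , r₂ | e₃ , r₃ | e₄ , r₄ | π , ρ = begin
  G s₁ s₂ s₃ s₄ P * G s₁ s₂ s₃ s₄ P  ≈⟨ square-cong 4 (G-cong r₁ r₂ r₃ r₄ ρ) ⟩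
  G t₁ t₂ t₃ t₄ Q * G t₁ t₂ t₃ t₄ Q  ≈⟨ G²≈R-on-bits e₁ e₂ e₃ e₄ π t₁₂≉t₃₄ ⟩
  R Q (t₁ * t₂ + t₃ * t₄)            ≈⟨ R-cong ρ (+-cong (*-cong r₁ r₂) (*-cong r₃ r₄)) ⟨
  R P (s₁ * s₂ + s₃ * s₄)            ∎
  where
  open ≈-Reasoning (≈-setoid 16)
  t₁ t₂ t₃ t₄ Q : ℤ
  t₁ = bit e₁; t₂ = bit e₂; t₃ = bit e₃; t₄ = bit e₄; Q = bit π
  t₁₂≉t₃₄ : ¬ (t₁ + t₂ ≈ t₃ + t₄ [mod 2 ])
  t₁₂≉t₃₄ t₁₂≈t₃₄ = s₁₂≉s₃₄ (≈-trans (+-cong r₁ r₂) (≈-trans t₁₂≈t₃₄ (≈-sym (+-cong r₃ r₄))))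

x+y≈x-y : ∀ x y → x + y ≈ x - y [mod 2 ]
x+y≈x-y x y = ≈-by-quotient y (identity x y)
  where identity : ∀ x y → x + y ≡ x - y + y * + 2
        identity = solve-∀

x≈-x : ∀ x → x ≈ - x [mod 2 ]
x≈-x x = ≈-by-quotient x (identity x)
  where identity : ∀ x → x ≡ - x + x * + 2
        identity = solve-∀

pair-sums≈differences : ∀ x₀ y₀ x₂ y₂ x₄ y₄ x₆ y₆ →
  ((x₀ + y₀) + (x₄ + y₄)) + ((x₂ + y₂) + (x₆ + y₆)) ≈ ((x₀ - y₀) - (x₂ - y₂)) + ((x₄ - y₄) - (x₆ - y₆)) [mod 2 ]
pair-sums≈differences x₀ y₀ x₂ y₂ x₄ y₄ x₆ y₆ = ≈-by-quotient (y₀ + x₂ + y₄ + x₆) (identity x₀ y₀ x₂ y₂ x₄ y₄ x₆ y₆)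
  where identity : ∀ x₀ y₀ x₂ y₂ x₄ y₄ x₆ y₆ →
          ((x₀ + y₀) + (x₄ + y₄)) + ((x₂ + y₂) + (x₆ + y₆))
          ≡ ((x₀ - y₀) - (x₂ - y₂)) + ((x₄ - y₄) - (x₆ - y₆)) + (y₀ + x₂ + y₄ + x₆) * + 2
        identity = solve-∀

lemma3p6 : (a : Fin 16 → ℤ) →
    ¬ ((b a (# 0) + b a (# 2)) ≡ (b a (# 1) + b a (# 3)) [mod 2 ]) →
    (F (dv a) * F (dv a)) ≡ (+ 1 - + 8 * dstar a - + 8 * dd a) [mod 16 ]
lemma3p6 a b₀₂≢b₁₃ = ≈⇒≡-mod (begin
  F w * F w                          ≡⟨ cong (λ x → x * x) (F≡G w) ⟩
  G s₁ s₂ s₃ s₄ P * G s₁ s₂ s₃ s₄ P  ≈⟨ G²≈R s₁ s₂ s₃ s₄ P s₁₂≉s₃₄ ⟩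
  R P (s₁ * s₂ + s₃ * s₄)            ≈⟨ R-cong dstar≈P dd≈s₁s₂+s₃s₄ ⟨
  R (dstar a) (dd a)                 ∎)
  where
  open ≈-Reasoning (≈-setoid 16)
  w : Fin 8 → ℤ
  w = dv a
  s₁ s₂ s₃ s₄ P : ℤ
  s₁ = w (# 0) - w (# 2); s₂ = w (# 4) - w (# 6); s₃ = w (# 1) - w (# 3); s₄ = w (# 5) - w (# 7)
  P = w (# 0) * w (# 2) + w (# 4) * w (# 6) - w (# 1) * w (# 3) - w (# 5) * w (# 7)
  dstar≈P : dstar a ≈ P [mod 2 ]
  dstar≈P = +-cong (+-cong (≈-refl {x = w (# 0) * w (# 2) + w (# 4) * w (# 6)}) (x≈-x (w (# 1) * w (# 3)))) (x≈-x (w (# 5) * w (# 7)))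
  dd≈s₁s₂+s₃s₄ : dd a ≈ s₁ * s₂ + s₃ * s₄ [mod 2 ]
  dd≈s₁s₂+s₃s₄ = +-cong (*-cong (x+y≈x-y (w (# 0)) (w (# 2))) (x+y≈x-y (w (# 4)) (w (# 6))))
                        (*-cong (x+y≈x-y (w (# 1)) (w (# 3))) (x+y≈x-y (w (# 5)) (w (# 7))))
  s₁₂≉s₃₄ : ¬ (s₁ + s₂ ≈ s₃ + s₄ [mod 2 ])
  s₁₂≉s₃₄ s₁₂≈s₃₄ = b₀₂≢b₁₃ (≈⇒≡-mod (≈-trans b₀₂≈s₁₂ (≈-trans s₁₂≈s₃₄ (≈-sym b₁₃≈s₃₄))))
    where
    b₀₂≈s₁₂ : b a (# 0) + b a (# 2) ≈ s₁ + s₂ [mod 2 ]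
    b₀₂≈s₁₂ = pair-sums≈differences (a (# 0)) (a (# 8)) (a (# 2)) (a (# 10)) (a (# 4)) (a (# 12)) (a (# 6)) (a (# 14))
    b₁₃≈s₃₄ : b a (# 1) + b a (# 3) ≈ s₃ + s₄ [mod 2 ]
    b₁₃≈s₃₄ = pair-sums≈differences (a (# 1)) (a (# 9)) (a (# 3)) (a (# 11)) (a (# 5)) (a (# 13)) (a (# 7)) (a (# 15))
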